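{- Let $\mathcal{F}$ be a nonempty family of subsets of $[n]$ and let $p$ be the probability that a uniformly random maximal chain from $\emptyset$ to $[n]$ contains at least one set of $\mathcal{F}$. Then there exist $A, A' \in \mathcal{F}$ such that $\ell_A^+(\mathcal{F}) \ge \ell(\mathcal{F})/p$ and $\ell_{A'}^-(\mathcal{F}) \ge \ell(\mathcal{F})/p$.
   Context: $[n]=\{1,\dots,n\}$. For $\mathcal{F}\subseteq 2^{[n]}$, $\ell(\mathcal{F})=\sum_{A\in\mathcal{F}}1/\binom{n}{|A|}$, the expected number of sets of $\mathcal{F}$ on a uniformly random maximal chain of $2^{[n]}$. For an interval $I=[X,Y]=\{Z: X\subseteq Z\subseteq Y\}$, $\ell(\mathcal{F};I)$ is the expected number of sets of $\mathcal{F}$ on a uniformly random maximal chain of $I$ (from $X$ to $Y$). Define $\ell_A^-(\mathcal{F})=\ell(\mathcal{F};[\emptyset,A])$ and $\ell_A^+(\mathcal{F})=\ell(\mathcal{F};[A,[n]])$. -}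

module Defs where

open import Data.Bool using (Bool; true; false; T; _∨_)
open import Data.Nat using (ℕ; zero; suc)
open import Data.Nat.Combinatorics using (_C_)
open import Data.Fin using (Fin)
import Data.Fin as Fin
open import Data.Fin.Subset using (Subset; ⁅_⁆; _∪_; _─_; ∣_∣; ⊥; ⊤)
open import Data.Vec using ([]; _∷_)
open import Data.List using (List; []; _∷_; map; concatMap; filterᵇ; length; foldr; _++_)
open import Data.Nat.ListAction using (sum)
open import Data.Bool.ListAction using (any)
open import Data.Integer using (+_)
open import Data.Rational using (ℚ; 0ℚ; _/_; _*_; _+_; _÷_; ≢-nonZero)
open import Data.Rational.Properties using (_≟_)
open import Relation.Nullary using (yes; no)

-- A family of subsets of [n] is given by its (decidable) membership
-- predicate.  A ∈ F  means  T (F A).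

Family : ℕ → Set
Family n = Subset n → Bool

allSubsets : (n : ℕ) → List (Subset n)
allSubsets zero    = [] ∷ []
allSubsets (suc n) = map (true ∷_) (allSubsets n) ++ map (false ∷_) (allSubsets n)

elems : ∀ {n} → Subset n → List (Fin n)
elems []           = []
elems (true  ∷ xs) = Fin.zero ∷ map Fin.suc (elems xs)
elems (false ∷ xs) = map Fin.suc (elems xs)

insertions : ∀ {A : Set} → A → List A → List (List A)
insertions x []       = (x ∷ []) ∷ []
insertions x (y ∷ ys) = (x ∷ y ∷ ys) ∷ map (y ∷_) (insertions x ys)

perms : ∀ {A : Set} → List A → List (List A)
perms []       = [] ∷ []
perms (x ∷ xs) = concatMap (insertions x) (perms xs)

chainFrom : ∀ {n} → Subset n → List (Fin n) → List (Subset n)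
chainFrom X []       = X ∷ []
chainFrom X (a ∷ as) = X ∷ chainFrom (X ∪ ⁅ a ⁆) as

-- All maximal chains of the interval [X,Y] (for X ⊆ Y): one for each
-- ordering of the elements of Y ∖ X (each listed exactly once).
maxChains : ∀ {n} → Subset n → Subset n → List (List (Subset n))
maxChains X Y = map (chainFrom X) (perms (elems (Y ─ X)))

ℕtoℚ : ℕ → ℚ
ℕtoℚ k = + k / 1

-- Division, total (x / 0 := 0); only ever used with nonzero divisors here.
_÷'_ : ℚ → ℚ → ℚ
x ÷' y with y ≟ 0ℚ
... | yes _  = 0ℚ
... | no y≢0 = _÷_ x y {{≢-nonZero y≢0}}

sumℚ : List ℚ → ℚ
sumℚ = foldr _+_ 0ℚ

countOn : ∀ {n} → Family n → List (Subset n) → ℕ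
countOn F c = length (filterᵇ F c)

ℓ : ∀ {n} → Family n → ℚ
ℓ {n} F = sumℚ (map (λ A → ℕtoℚ 1 ÷' ℕtoℚ (n C ∣ A ∣)) (filterᵇ F (allSubsets n)))

-- ℓ(F; [X,Y]) : expected number of sets of F on a uniformly random
-- maximal chain of the interval [X,Y].
ℓI : ∀ {n} → Family n → Subset n → Subset n → ℚ
ℓI F X Y = ℕtoℚ (sum (map (countOn F) (maxChains X Y))) ÷' ℕtoℚ (length (maxChains X Y))

ℓ⁻ : ∀ {n} → Subset n → Family n → ℚ
ℓ⁻ A F = ℓI F ⊥ A

ℓ⁺ : ∀ {n} → Subset n → Family n → ℚ
ℓ⁺ A F = ℓI F A ⊤

hitProb : ∀ {n} → Family n → ℚ
hitProb {n} F =
  ℕtoℚ (length (filterᵇ (any F) (maxChains {n} ⊥ ⊤))) ÷' ℕtoℚ (length (maxChains {n} ⊥ ⊤))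

-- For a set X let G(X) be the number of F-sets counted over all maximal chains of [X,[n]],
-- H(X) the number of those chains meeting F and L(X) = |[n]∖X|! the number of all of them,
-- so that ℓ⁺_X(F) = G(X)/L(X).  Choose A ∈ F maximising G(A)/L(A).  A chain from X either
-- starts inside F (then H(X) = L(X) and G(X)/H(X) ≤ G(A)/L(A) by the choice of A) or starts
-- outside F, and then G(X) and H(X) are the sums of G and H over the sets X ∪ {a}; induction
-- on |[n]∖X| gives G(X)·L(A) ≤ G(A)·H(X) for all X (module BestRatio).  At X = ∅ this is
-- ℓ(F)/p ≤ ℓ⁺_A(F), since ℓ(F) = G(∅)/n! (each set A lies on |A|!(n−|A|)! maximal chains)
-- and p = H(∅)/n!.  The statement for ℓ⁻ is the mirror image: the chains of [∅,Y] are split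
-- at their last step instead of their first.
module Submission where

module RatioArithmetic where

  open import Data.Nat as ℕ using (ℕ; zero; suc; NonZero)
  import Data.Nat.Properties as ℕ
  open import Data.Integer as ℤ using (+_)
  import Data.Integer.Properties as ℤ
  import Data.Rational as ℚ
  open import Data.Rational using (ℚ; 0ℚ; 1ℚ; _+_; _*_; _≤_; 1/_; toℚᵘ; Positive; ≢-nonZero)
  open import Data.Rational.Properties
  open import Data.Rational.Unnormalised as ℚᵘ using (ℚᵘ; mkℚᵘ; *≡*; *≤*)
  import Data.Rational.Unnormalised.Properties as ℚᵘ
  open import Data.List using (List; []; _∷_; map)
  open import Data.Nat.ListAction using (sum)
  open import Relation.Binary.PropositionalEquality
  open import Relation.Nullary using (yes; no)
  open import Relation.Nullary.Negation using (contradiction)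
  open import Defs using (ℕtoℚ; _÷'_; sumℚ)

  ι : ℕ → ℚ
  ι = ℕtoℚ

  private
    ιᵘ : ℕ → ℚᵘ
    ιᵘ a = mkℚᵘ (+ a) 0

    toℚᵘ-ι : ∀ a → toℚᵘ (ι a) ℚᵘ.≃ ιᵘ a
    toℚᵘ-ι a = toℚᵘ-fromℚᵘ (ιᵘ a)

  ι-+ : ∀ a b → ι (a ℕ.+ b) ≡ ι a + ι b
  ι-+ a b = toℚᵘ-injective (ℚᵘ.≃-trans (toℚᵘ-ι (a ℕ.+ b)) (ℚᵘ.≃-trans unnormalised
    (ℚᵘ.≃-sym (ℚᵘ.≃-trans (toℚᵘ-homo-+ (ι a) (ι b)) (ℚᵘ.+-cong (toℚᵘ-ι a) (toℚᵘ-ι b))))))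
    where
    unnormalised : ιᵘ (a ℕ.+ b) ℚᵘ.≃ ιᵘ a ℚᵘ.+ ιᵘ b
    unnormalised = *≡* (trans (ℤ.*-identityʳ _) (sym (trans (ℤ.*-identityʳ _)
      (trans (cong₂ ℤ._+_ (ℤ.*-identityʳ (+ a)) (ℤ.*-identityʳ (+ b))) (sym (ℤ.pos-+ a b))))))

  ι-* : ∀ a b → ι (a ℕ.* b) ≡ ι a * ι b
  ι-* a b = toℚᵘ-injective (ℚᵘ.≃-trans (toℚᵘ-ι (a ℕ.* b)) (ℚᵘ.≃-trans unnormalised
    (ℚᵘ.≃-sym (ℚᵘ.≃-trans (toℚᵘ-homo-* (ι a) (ι b)) (ℚᵘ.*-cong (toℚᵘ-ι a) (toℚᵘ-ι b))))))
    where
    unnormalised : ιᵘ (a ℕ.* b) ℚᵘ.≃ ιᵘ a ℚᵘ.* ιᵘ b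
    unnormalised = *≡* (trans (ℤ.*-identityʳ _) (sym (trans (ℤ.*-identityʳ _) (sym (ℤ.pos-* a b)))))

  ι-mono-≤ : ∀ {a b} → a ℕ.≤ b → ι a ≤ ι b
  ι-mono-≤ {a} {b} a≤b = toℚᵘ-cancel-≤ (ℚᵘ.≤-respˡ-≃ (ℚᵘ.≃-sym (toℚᵘ-ι a)) (ℚᵘ.≤-respʳ-≃ (ℚᵘ.≃-sym (toℚᵘ-ι b))
    (*≤* (subst₂ ℤ._≤_ (sym (ℤ.*-identityʳ _)) (sym (ℤ.*-identityʳ _)) (ℤ.+≤+ a≤b)))))

  ι-cancel-≤ : ∀ {a b} → ι a ≤ ι b → a ℕ.≤ b
  ι-cancel-≤ {a} {b} ιa≤ιb = ℤ.drop‿+≤+ (subst₂ ℤ._≤_ (ℤ.*-identityʳ _) (ℤ.*-identityʳ _)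
    (ℚᵘ.drop-*≤* (ℚᵘ.≤-respˡ-≃ (toℚᵘ-ι a) (ℚᵘ.≤-respʳ-≃ (toℚᵘ-ι b) (toℚᵘ-mono-≤ ιa≤ιb)))))

  ι-pos : ∀ a .{{_ : NonZero a}} → Positive (ι a)
  ι-pos a = normalize-pos a 1

  ι-≢0 : ∀ a .{{_ : NonZero a}} → ι a ≢ 0ℚ
  ι-≢0 a ιa≡0 = <⇒≢ (positive⁻¹ (ι a) {{ι-pos a}}) (sym ιa≡0)

  ÷'-inverse : ∀ x y → y ≢ 0ℚ → (x ÷' y) * y ≡ x
  ÷'-inverse x y y≢0 with y ≟ 0ℚ
  ... | yes y≡0 = contradiction y≡0 y≢0
  ... | no  y≢0 = trans (*-assoc x _ y) (trans (cong (x *_) (*-inverseˡ y {{≢-nonZero y≢0}})) (*-identityʳ x))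

  ÷'-unique : ∀ x y z → y ≢ 0ℚ → z * y ≡ x → z ≡ x ÷' y
  ÷'-unique x y z y≢0 zy≡x with y ≟ 0ℚ
  ... | yes y≡0 = contradiction y≡0 y≢0
  ... | no  y≢0 = begin
      z                    ≡⟨ *-identityʳ z ⟨
      z * 1ℚ               ≡⟨ cong (z *_) (*-inverseʳ y) ⟨
      z * (y * 1/ y)       ≡⟨ *-assoc z y _ ⟨
      z * y * 1/ y         ≡⟨ cong (_* 1/ y) zy≡x ⟩
      x * 1/ y             ∎
    where
    open ≡-Reasoning
    instance
      y-nonZero : ℚ.NonZero y
      y-nonZero = ≢-nonZero y≢0

  0÷' : ∀ y → 0ℚ ÷' y ≡ 0ℚ
  0÷' y with y ≟ 0ℚ
  ... | yes _   = refl
  ... | no  y≢0 = *-zeroˡ (1/_ y {{≢-nonZero y≢0}})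

  ÷'-common : ∀ x y n → y ≢ 0ℚ → n ≢ 0ℚ → (x ÷' n) ÷' (y ÷' n) ≡ x ÷' y
  ÷'-common x y n y≢0 n≢0 = ÷'-unique x y q y≢0 (begin
      q * y                    ≡⟨ cong (q *_) (÷'-inverse y n n≢0) ⟨
      q * ((y ÷' n) * n)       ≡⟨ *-assoc q (y ÷' n) n ⟨
      q * (y ÷' n) * n         ≡⟨ cong (_* n) (÷'-inverse (x ÷' n) (y ÷' n) y÷n≢0) ⟩
      (x ÷' n) * n             ≡⟨ ÷'-inverse x n n≢0 ⟩
      x                        ∎)
    where
    open ≡-Reasoning
    q = (x ÷' n) ÷' (y ÷' n)
    y÷n≢0 : y ÷' n ≢ 0ℚ
    y÷n≢0 y÷n≡0 = y≢0 (trans (sym (÷'-inverse y n n≢0)) (trans (cong (_* n) y÷n≡0) (*-zeroˡ n)))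

  private
    ratio-scale : ∀ a b d .{{_ : NonZero b}} → (ι a ÷' ι b) * ι (b ℕ.* d) ≡ ι (a ℕ.* d)
    ratio-scale a b d = begin
        (ι a ÷' ι b) * ι (b ℕ.* d)     ≡⟨ cong ((ι a ÷' ι b) *_) (ι-* b d) ⟩
        (ι a ÷' ι b) * (ι b * ι d)     ≡⟨ *-assoc (ι a ÷' ι b) (ι b) (ι d) ⟨
        (ι a ÷' ι b) * ι b * ι d       ≡⟨ cong (_* ι d) (÷'-inverse (ι a) (ι b) (ι-≢0 b)) ⟩
        ι a * ι d                      ≡⟨ ι-* a d ⟨
        ι (a ℕ.* d)                    ∎
      where open ≡-Reasoning

    ratio-scale′ : ∀ c b d .{{_ : NonZero d}} → (ι c ÷' ι d) * ι (b ℕ.* d) ≡ ι (c ℕ.* b)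
    ratio-scale′ c b d = trans (cong (λ m → (ι c ÷' ι d) * ι m) (ℕ.*-comm b d)) (ratio-scale c d b)

  ratio-≤ : ∀ a b c d .{{_ : NonZero b}} .{{_ : NonZero d}} → a ℕ.* d ℕ.≤ c ℕ.* b → ι a ÷' ι b ≤ ι c ÷' ι d
  ratio-≤ a b c d ad≤cb = *-cancelʳ-≤-pos (ι (b ℕ.* d)) {{ι-pos (b ℕ.* d) {{ℕ.m*n≢0 b d}}}}
    (subst₂ _≤_ (sym (ratio-scale a b d)) (sym (ratio-scale′ c b d)) (ι-mono-≤ ad≤cb))

  ratio-≤⁻ : ∀ a b c d .{{_ : NonZero b}} .{{_ : NonZero d}} → ι a ÷' ι b ≤ ι c ÷' ι d → a ℕ.* d ℕ.≤ c ℕ.* b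
  ratio-≤⁻ a b c d ratio≤ = ι-cancel-≤ (subst₂ _≤_ (ratio-scale a b d) (ratio-scale′ c b d)
    (*-monoʳ-≤-nonNeg (ι (b ℕ.* d)) {{pos⇒nonNeg (ι (b ℕ.* d)) {{ι-pos (b ℕ.* d) {{ℕ.m*n≢0 b d}}}}}} ratio≤))

  -- The final estimate: with x = G/N and p = H/N, if G/H ≤ Gs/Ls (in cross-multiplied
  -- form) then x/p ≤ Gs/Ls; for H = 0 the quotient x/p is 0 by the convention of _÷'_.
  ratio-of-ratios-≤ : ∀ G H N Gs Ls .{{_ : NonZero N}} .{{_ : NonZero Ls}} →
    G ℕ.* Ls ℕ.≤ Gs ℕ.* H → (ι G ÷' ι N) ÷' (ι H ÷' ι N) ≤ ι Gs ÷' ι Ls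
  ratio-of-ratios-≤ G zero    N Gs Ls _ = subst (_≤ ι Gs ÷' ι Ls) (cong ((ι G ÷' ι N) ÷'_) (sym (0÷' (ι N))))
    (ratio-≤ 0 1 Gs Ls ℕ.z≤n)
  ratio-of-ratios-≤ G (suc h) N Gs Ls GLs≤GsH = subst (_≤ ι Gs ÷' ι Ls) (sym (÷'-common (ι G) (ι (suc h)) (ι N) (ι-≢0 (suc h)) (ι-≢0 N)))
    (ratio-≤ G (suc h) Gs Ls GLs≤GsH)

  module _ {A : Set} where

    sumℚ-*ʳ : ∀ (h : A → ℚ) xs c → sumℚ (map h xs) * c ≡ sumℚ (map (λ x → h x * c) xs)
    sumℚ-*ʳ h []       c = *-zeroˡ c
    sumℚ-*ʳ h (x ∷ xs) c = trans (*-distribʳ-+ c (h x) _) (cong (_+_ (h x * c)) (sumℚ-*ʳ h xs c))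

    sumℚ-cong : ∀ {h h′ : A → ℚ} xs → (∀ x → h x ≡ h′ x) → sumℚ (map h xs) ≡ sumℚ (map h′ xs)
    sumℚ-cong []       h≡h′ = refl
    sumℚ-cong (x ∷ xs) h≡h′ = cong₂ _+_ (h≡h′ x) (sumℚ-cong xs h≡h′)

    sumℚ-ι : ∀ (g : A → ℕ) xs → sumℚ (map (λ x → ι (g x)) xs) ≡ ι (sum (map g xs))
    sumℚ-ι g []       = refl
    sumℚ-ι g (x ∷ xs) = trans (cong (_+_ (ι (g x))) (sumℚ-ι g xs)) (sym (ι-+ (g x) (sum (map g xs))))

open RatioArithmetic

open import Algebra.Properties.CommutativeSemigroup using (interchange)
open import Data.Bool using (Bool; true; false; T; _∨_; if_then_else_)
import Data.Bool as Bool
open import Data.Bool.ListAction using (any)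
open import Data.Bool.Properties using (T-≡)
open import Data.Fin using (Fin; zero; suc)
open import Data.Fin.Properties using () renaming (_≟_ to _≟ᶠ_)
open import Data.Fin.Subset using (Subset; ⁅_⁆; _∪_; _─_; _-_; ∣_∣; _⊆_; ∁)
  renaming (_∈_ to _∈ₛ_; _∉_ to _∉ₛ_; ⊥ to ∅; ⊤ to full)
open import Data.Fin.Subset.Properties
  using ( _∈?_; p─⊥≡p; p─q─r≡p─q∪r; p─q─r≡p─r─q; p─q⊆p; x∈p∪q⁻; x∈⁅y⁆⇒x≡y; x∈⁅x⁆; x∈p∧x∉q⇒x∈p─q
        ; x∈p⇒∣p-x∣<∣p∣; p⊆p∪q; q⊆p∪q; ⊆-refl; ⊆-min; ⊆-antisym; Empty-unique; ∣⊥∣≡0; ∣∁p∣≡n∸∣p∣; ∣p∣≤n)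
open import Data.List using (List; []; _∷_; _++_; _∷ʳ_; map; concat; concatMap; filterᵇ; length)
import Data.List.Properties as List
open import Data.List.Membership.Propositional using (_∈_)
open import Data.List.Membership.Propositional.Properties using (∈-map⁺; ∈-map⁻; ∈-++⁺ˡ; ∈-++⁺ʳ; ∈-filter⁺)
open import Data.List.Relation.Unary.All using (lookup)
open import Data.List.Relation.Unary.All.Properties using (all-filter)
open import Data.List.Relation.Unary.Any using (here; there)
open import Data.Nat hiding (∣_-_∣)
open import Data.Nat.Combinatorics using (_C_; nCk≡n!/k![n-k]!; k![n∸k]!∣n!)
open import Data.Nat.DivMod using (m/n*n≡m)
open import Data.Nat.Induction using (<-wellFounded)
open import Data.Nat.ListAction using (sum)
open import Data.Nat.Properties
open import Data.Product using (Σ; ∃; _×_; _,_; proj₁; proj₂)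
open import Data.Sum using (inj₁; inj₂)
import Data.Rational as ℚ
import Data.Rational.Properties as ℚ
open import Data.Vec using ([]; _∷_; here; there)
open import Data.Vec.Properties using (≡-dec)
open import Function using (_∘_; _on_; Equivalence)
open import Induction.WellFounded using (WellFounded; Acc; acc)
open import Relation.Binary.Bundles using (DecTotalOrder)
import Relation.Binary.Construct.On as On
open import Relation.Binary.Definitions using (DecidableEquality)
open import Relation.Binary.PropositionalEquality
open import Relation.Nullary using (yes; no; does; ¬_)
open import Relation.Nullary.Decidable using (T?; dec-true; dec-false)
open import Relation.Nullary.Negation using (contradiction)
import Data.List.Extrema (DecTotalOrder.totalOrder ℚ.≤-decTotalOrder) as Extrema

open import Defs

private
  variable
    n : ℕ

  +-interchange : ∀ a b c d → (a + b) + (c + d) ≡ (a + c) + (b + d)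
  +-interchange = interchange +-commutativeSemigroup

∑ : {A : Set} → List A → (A → ℕ) → ℕ
∑ []       f = 0
∑ (x ∷ xs) f = f x + ∑ xs f

syntax ∑ xs (λ x → e) = ∑[ x ← xs ] e

ind : Bool → ℕ
ind b = if b then 1 else 0

module _ {A : Set} where

  ∑-++ : ∀ (xs ys : List A) f → ∑ (xs ++ ys) f ≡ ∑ xs f + ∑ ys f
  ∑-++ []       ys f = refl
  ∑-++ (x ∷ xs) ys f = trans (cong (f x +_) (∑-++ xs ys f)) (sym (+-assoc (f x) _ _))

  ∑-cong : ∀ (xs : List A) {f g} → (∀ x → f x ≡ g x) → ∑ xs f ≡ ∑ xs g
  ∑-cong []       f≡g = refl
  ∑-cong (x ∷ xs) f≡g = cong₂ _+_ (f≡g x) (∑-cong xs f≡g)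

  ∑-cong∈ : ∀ (xs : List A) {f g} → (∀ x → x ∈ xs → f x ≡ g x) → ∑ xs f ≡ ∑ xs g
  ∑-cong∈ []       f≡g = refl
  ∑-cong∈ (x ∷ xs) f≡g = cong₂ _+_ (f≡g x (here refl)) (∑-cong∈ xs (λ y y∈ → f≡g y (there y∈)))

  ∑-mono∈ : ∀ (xs : List A) {f g} → (∀ x → x ∈ xs → f x ≤ g x) → ∑ xs f ≤ ∑ xs g
  ∑-mono∈ []       f≤g = z≤n
  ∑-mono∈ (x ∷ xs) f≤g = +-mono-≤ (f≤g x (here refl)) (∑-mono∈ xs (λ y y∈ → f≤g y (there y∈)))

  ∑-+ : ∀ (xs : List A) f g → ∑[ x ← xs ] (f x + g x) ≡ ∑ xs f + ∑ xs g
  ∑-+ []       f g = refl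
  ∑-+ (x ∷ xs) f g =
    trans (cong (f x + g x +_) (∑-+ xs f g)) (+-interchange (f x) (g x) (∑ xs f) (∑ xs g))

  ∑-*ˡ : ∀ (xs : List A) c f → ∑[ x ← xs ] (c * f x) ≡ c * ∑ xs f
  ∑-*ˡ []       c f = sym (*-zeroʳ c)
  ∑-*ˡ (x ∷ xs) c f = trans (cong (c * f x +_) (∑-*ˡ xs c f)) (sym (*-distribˡ-+ c (f x) _))

  ∑-*ʳ : ∀ (xs : List A) c f → ∑[ x ← xs ] (f x * c) ≡ ∑ xs f * c
  ∑-*ʳ xs c f = trans (∑-cong xs (λ x → *-comm (f x) c)) (trans (∑-*ˡ xs c f) (*-comm c (∑ xs f)))

  ∑-zero : ∀ (xs : List A) {f} → (∀ x → x ∈ xs → f x ≡ 0) → ∑ xs f ≡ 0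
  ∑-zero []       f≡0 = refl
  ∑-zero (x ∷ xs) f≡0 = cong₂ _+_ (f≡0 x (here refl)) (∑-zero xs (λ y y∈ → f≡0 y (there y∈)))

  ∑-const : ∀ (xs : List A) c → ∑[ _ ← xs ] c ≡ length xs * c
  ∑-const []       c = refl
  ∑-const (x ∷ xs) c = cong (c +_) (∑-const xs c)

  length≡∑1 : ∀ (xs : List A) → length xs ≡ ∑[ _ ← xs ] 1
  length≡∑1 xs = sym (trans (∑-const xs 1) (*-identityʳ (length xs)))

  length-filter : ∀ (p : A → Bool) xs → length (filterᵇ p xs) ≡ ∑[ x ← xs ] ind (p x)
  length-filter p []       = refl
  length-filter p (x ∷ xs) with p x
  ... | true  = cong suc (length-filter p xs)
  ... | false = length-filter p xs

  ∑-filter : ∀ (p : A → Bool) xs f → ∑ (filterᵇ p xs) f ≡ ∑[ x ← xs ] (ind (p x) * f x)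
  ∑-filter p []       f = refl
  ∑-filter p (x ∷ xs) f with p x
  ... | true  = cong₂ _+_ (sym (+-identityʳ (f x))) (∑-filter p xs f)
  ... | false = ∑-filter p xs f

module _ {A B : Set} where

  ∑-map : ∀ (g : A → B) (xs : List A) f → ∑ (map g xs) f ≡ ∑ xs (f ∘ g)
  ∑-map g []       f = refl
  ∑-map g (x ∷ xs) f = cong (f (g x) +_) (∑-map g xs f)

  ∑-concatMap : ∀ (g : A → List B) (xs : List A) f →
    ∑ (concatMap g xs) f ≡ ∑[ x ← xs ] ∑ (g x) f
  ∑-concatMap g []       f = refl
  ∑-concatMap g (x ∷ xs) f =
    trans (∑-++ (g x) (concat (map g xs)) f) (cong (∑ (g x) f +_) (∑-concatMap g xs f))

  ∑-swap : ∀ (xs : List A) (ys : List B) (φ : A → B → ℕ) →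
    ∑[ x ← xs ] ∑[ y ← ys ] φ x y ≡ ∑[ y ← ys ] ∑[ x ← xs ] φ x y
  ∑-swap []       ys φ = sym (trans (∑-const ys 0) (*-zeroʳ (length ys)))
  ∑-swap (x ∷ xs) ys φ =
    trans (cong (∑ ys (φ x) +_) (∑-swap xs ys φ)) (sym (∑-+ ys (φ x) (λ y → ∑[ x ← xs ] φ x y)))

sum-map : ∀ {A : Set} (f : A → ℕ) xs → sum (map f xs) ≡ ∑ xs f
sum-map f []       = refl
sum-map f (x ∷ xs) = cong (f x +_) (sum-map f xs)

select : {A : Set} → List A → List (A × List A)
select []       = []
select (x ∷ xs) = (x , xs) ∷ map (λ p → proj₁ p , x ∷ proj₂ p) (select xs)

select-map : ∀ {A B : Set} (f : A → B) (xs : List A) →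
  select (map f xs) ≡ map (λ p → f (proj₁ p) , map f (proj₂ p)) (select xs)
select-map f []       = refl
select-map f (x ∷ xs) = cong ((f x , map f xs) ∷_) (begin
    map (λ p → proj₁ p , f x ∷ proj₂ p) (select (map f xs))
  ≡⟨ cong (map _) (select-map f xs) ⟩
    map (λ p → proj₁ p , f x ∷ proj₂ p) (map (λ p → f (proj₁ p) , map f (proj₂ p)) (select xs))
  ≡⟨ sym (List.map-∘ (select xs)) ⟩
    map (λ p → f (proj₁ p) , f x ∷ map f (proj₂ p)) (select xs)
  ≡⟨ List.map-∘ (select xs) ⟩
    map (λ p → f (proj₁ p) , map f (proj₂ p)) (map (λ p → proj₁ p , x ∷ proj₂ p) (select xs))
  ∎)
  where open ≡-Reasoning

module _ {A : Set} where

  private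
    ∑-perms-cons : ∀ (x : A) xs h →
      ∑ (perms (x ∷ xs)) h ≡ ∑[ π ← perms xs ] ∑ (insertions x π) h
    ∑-perms-cons x xs h = ∑-concatMap (insertions x) (perms xs) h

    ∑-insertions : ∀ (x a : A) ρ h →
      ∑ (insertions x (a ∷ ρ)) h ≡ h (x ∷ a ∷ ρ) + ∑[ τ ← insertions x ρ ] h (a ∷ τ)
    ∑-insertions x a ρ h = cong (h (x ∷ a ∷ ρ) +_) (∑-map (a ∷_) (insertions x ρ) h)

  -- Classifying the permutations of x ∷ xs by their first entry: either x itself,
  -- or some entry a of xs, followed by a permutation of the rest together with x.
  perms-first′ : ∀ (x : A) xs h →
    ∑ (perms (x ∷ xs)) h
      ≡ ∑[ τ ← perms xs ] h (x ∷ τ)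
        + ∑[ p ← select xs ] ∑[ τ ← perms (x ∷ proj₂ p) ] h (proj₁ p ∷ τ)
  perms-first′ x []       h = cong (_+ 0) (+-comm 0 (h (x ∷ [])))
  perms-first′ x (y ∷ ys) h = begin
      ∑ (perms (x ∷ y ∷ ys)) h
    ≡⟨ ∑-perms-cons x (y ∷ ys) h ⟩
      ∑ (perms (y ∷ ys)) h′
    ≡⟨ perms-first′ y ys h′ ⟩
      ∑[ τ ← perms ys ] h′ (y ∷ τ) + ∑[ p ← select ys ] ∑[ τ ← perms (y ∷ proj₂ p) ] h′ (proj₁ p ∷ τ)
    ≡⟨ cong₂ _+_ y-first a-first ⟩
      (xy + yx) + (xa + ax)
    ≡⟨ +-interchange xy yx xa ax ⟩
      (xy + xa) + (yx + ax)
    ≡⟨ cong₂ _+_ (sym (perms-first′ y ys (λ τ → h (x ∷ τ))))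
                 (cong (yx +_) (sym (∑-map (λ p → proj₁ p , y ∷ proj₂ p) (select ys) _))) ⟩
      ∑[ τ ← perms (y ∷ ys) ] h (x ∷ τ)
        + ∑[ p ← select (y ∷ ys) ] ∑[ τ ← perms (x ∷ proj₂ p) ] h (proj₁ p ∷ τ)
    ∎
    where
    open ≡-Reasoning
    h′ : List A → ℕ
    h′ π = ∑ (insertions x π) h
    xy yx xa ax : ℕ
    xy = ∑[ τ ← perms ys ] h (x ∷ y ∷ τ)
    yx = ∑[ τ ← perms (x ∷ ys) ] h (y ∷ τ)
    xa = ∑[ p ← select ys ] ∑[ τ ← perms (y ∷ proj₂ p) ] h (x ∷ proj₁ p ∷ τ)
    ax = ∑[ p ← select ys ] ∑[ τ ← perms (x ∷ y ∷ proj₂ p) ] h (proj₁ p ∷ τ)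
    insert-x : ∀ a ρ → h′ (a ∷ ρ) ≡ h (x ∷ a ∷ ρ) + ∑[ τ ← insertions x ρ ] h (a ∷ τ)
    insert-x a ρ = ∑-insertions x a ρ h
    y-first : ∑[ τ ← perms ys ] h′ (y ∷ τ) ≡ xy + yx
    y-first = trans (∑-cong (perms ys) (insert-x y))
      (trans (∑-+ (perms ys) _ _) (cong (xy +_) (sym (∑-perms-cons x ys (λ τ → h (y ∷ τ))))))
    a-first : ∑[ p ← select ys ] ∑[ τ ← perms (y ∷ proj₂ p) ] h′ (proj₁ p ∷ τ) ≡ xa + ax
    a-first = trans
      (∑-cong (select ys) (λ p → trans (∑-cong (perms (y ∷ proj₂ p)) (insert-x (proj₁ p)))
        (trans (∑-+ (perms (y ∷ proj₂ p)) _ _)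
          (cong (∑[ τ ← perms (y ∷ proj₂ p) ] h (x ∷ proj₁ p ∷ τ) +_)
            (sym (∑-perms-cons x (y ∷ proj₂ p) (λ τ → h (proj₁ p ∷ τ))))))))
      (∑-+ (select ys) _ _)

  perms-first : ∀ (x : A) xs h →
    ∑ (perms (x ∷ xs)) h ≡ ∑[ p ← select (x ∷ xs) ] ∑[ τ ← perms (proj₂ p) ] h (proj₁ p ∷ τ)
  perms-first x xs h = trans (perms-first′ x xs h)
    (cong (∑[ τ ← perms xs ] h (x ∷ τ) +_) (sym (∑-map (λ p → proj₁ p , x ∷ proj₂ p) (select xs) _)))

length-elems : (T : Subset n) → length (elems T) ≡ ∣ T ∣
length-elems []          = refl
length-elems (true ∷ T)  = cong suc (trans (List.length-map suc (elems T)) (length-elems T))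
length-elems (false ∷ T) = trans (List.length-map suc (elems T)) (length-elems T)

elems-sound : (T : Subset n) {a : Fin n} → a ∈ elems T → a ∈ₛ T
elems-sound (true ∷ T)  {zero}  _ = here
elems-sound (false ∷ T) {zero}  a∈ with ∈-map⁻ suc a∈
... | _ , _ , ()
elems-sound (true ∷ T)  {suc a} (there a∈) with ∈-map⁻ suc a∈
... | _ , b∈ , refl = there (elems-sound T b∈)
elems-sound (false ∷ T) {suc a} a∈ with ∈-map⁻ suc a∈
... | _ , b∈ , refl = there (elems-sound T b∈)

∣-∣-remove : (T : Subset n) {a : Fin n} → a ∈ₛ T → suc ∣ T - a ∣ ≡ ∣ T ∣
∣-∣-remove (true ∷ T)  here      = cong suc (cong ∣_∣ (p─⊥≡p T))
∣-∣-remove (true ∷ T)  (there a∈) = cong suc (∣-∣-remove T a∈)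
∣-∣-remove (false ∷ T) (there a∈) = ∣-∣-remove T a∈

private
  sucPair : Fin n × List (Fin n) → Fin (suc n) × List (Fin (suc n))
  sucPair p = suc (proj₁ p) , map suc (proj₂ p)

select-elems : (T : Subset n) → select (elems T) ≡ map (λ a → a , elems (T - a)) (elems T)
select-elems []          = refl
select-elems (true ∷ T)  = cong₂ (λ r rs → (zero , r) ∷ rs) (cong (map suc ∘ elems) (sym (p─⊥≡p T))) (begin
    map (λ p → proj₁ p , zero ∷ proj₂ p) (select (map suc (elems T)))
  ≡⟨ cong (map _) (select-map suc (elems T)) ⟩
    map (λ p → proj₁ p , zero ∷ proj₂ p) (map sucPair (select (elems T)))
  ≡⟨ cong (λ z → map (λ p → proj₁ p , zero ∷ proj₂ p) (map sucPair z)) (select-elems T) ⟩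
    map (λ p → proj₁ p , zero ∷ proj₂ p) (map sucPair (map (λ a → a , elems (T - a)) (elems T)))
  ≡⟨ cong (map _) (sym (List.map-∘ (elems T))) ⟩
    map (λ p → proj₁ p , zero ∷ proj₂ p) (map (λ a → suc a , map suc (elems (T - a))) (elems T))
  ≡⟨ sym (List.map-∘ (elems T)) ⟩
    map (λ a → suc a , elems ((true ∷ T) - suc a)) (elems T)
  ≡⟨ List.map-∘ (elems T) ⟩
    map (λ a → a , elems ((true ∷ T) - a)) (map suc (elems T))
  ∎)
  where open ≡-Reasoning
select-elems (false ∷ T) = begin
    select (map suc (elems T))
  ≡⟨ select-map suc (elems T) ⟩
    map sucPair (select (elems T))
  ≡⟨ cong (map sucPair) (select-elems T) ⟩
    map sucPair (map (λ a → a , elems (T - a)) (elems T))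
  ≡⟨ sym (List.map-∘ (elems T)) ⟩
    map (λ a → suc a , elems ((false ∷ T) - suc a)) (elems T)
  ≡⟨ List.map-∘ (elems T) ⟩
    map (λ a → a , elems ((false ∷ T) - a)) (map suc (elems T))
  ∎
  where open ≡-Reasoning

omit : Fin n → Fin n → ℕ → ℕ
omit b a x = if does (a ≟ᶠ b) then 0 else x

omit-sym : (a b : Fin n) (x : ℕ) → omit b a x ≡ omit a b x
omit-sym a b x with a ≟ᶠ b | b ≟ᶠ a
... | yes _   | yes _   = refl
... | no _    | no _    = refl
... | yes a≡b | no b≢a  = contradiction (sym a≡b) b≢a
... | no a≢b  | yes b≡a = contradiction (sym b≡a) a≢b

private
  ∑-remove-head : (T : Subset n) (ψ : Fin (suc n) → ℕ) →
    ∑ (map suc (elems (T ─ ∅))) ψ ≡ ∑[ a ← map suc (elems T) ] omit zero a (ψ a)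
  ∑-remove-head T ψ = trans (cong (λ z → ∑ (map suc (elems z)) ψ) (p─⊥≡p T))
    (trans (∑-map suc (elems T) ψ) (sym (∑-map suc (elems T) _)))

∑-remove : (T : Subset n) (b : Fin n) (ψ : Fin n → ℕ) →
  ∑ (elems (T - b)) ψ ≡ ∑[ a ← elems T ] omit b a (ψ a)
∑-remove (true ∷ T)  zero    ψ = ∑-remove-head T ψ
∑-remove (false ∷ T) zero    ψ = ∑-remove-head T ψ
∑-remove (true ∷ T)  (suc b) ψ = cong (ψ zero +_)
  (trans (∑-map suc (elems (T - b)) ψ) (trans (∑-remove T b (ψ ∘ suc)) (sym (∑-map suc (elems T) _))))
∑-remove (false ∷ T) (suc b) ψ =
  trans (∑-map suc (elems (T - b)) ψ) (trans (∑-remove T b (ψ ∘ suc)) (sym (∑-map suc (elems T) _)))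

∑-pairs-swap : (T : Subset n) (φ : Fin n → Fin n → ℕ) →
  ∑[ a ← elems T ] ∑[ b ← elems (T - a) ] φ a b ≡ ∑[ b ← elems T ] ∑[ a ← elems (T - b) ] φ a b
∑-pairs-swap {n} T φ = begin
    ∑[ a ← E ] ∑[ b ← elems (T - a) ] φ a b
  ≡⟨ ∑-cong E (λ a → ∑-remove T a (φ a)) ⟩
    ∑[ a ← E ] ∑[ b ← E ] omit a b (φ a b)
  ≡⟨ ∑-swap E E _ ⟩
    ∑[ b ← E ] ∑[ a ← E ] omit a b (φ a b)
  ≡⟨ ∑-cong E (λ b → ∑-cong E (λ a → omit-sym b a (φ a b))) ⟩
    ∑[ b ← E ] ∑[ a ← E ] omit b a (φ a b)
  ≡⟨ ∑-cong E (λ b → sym (∑-remove T b (λ a → φ a b))) ⟩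
    ∑[ b ← elems T ] ∑[ a ← elems (T - b) ] φ a b
  ∎
  where
  open ≡-Reasoning
  E : List (Fin n)
  E = elems T

elems-empty : (T : Subset n) → ∣ T ∣ ≡ 0 → elems T ≡ []
elems-empty T ∣T∣≡0 with elems T | length-elems T
... | []     | _     = refl
... | _ ∷ _ | 1+l≡∣T∣ = contradiction (trans 1+l≡∣T∣ ∣T∣≡0) (λ ())

elems-nonempty : (T : Subset n) {k : ℕ} → ∣ T ∣ ≡ suc k → Σ (Fin n) λ e → Σ (List (Fin n)) λ es → elems T ≡ e ∷ es
elems-nonempty T ∣T∣≡1+k with elems T | length-elems T
... | e ∷ es | _ = e , es , refl
... | []     | 0≡∣T∣ = contradiction (trans 0≡∣T∣ ∣T∣≡1+k) (λ ())

x∈p─q⇒x∉q : ∀ (p q : Subset n) {x} → x ∈ₛ p ─ q → x ∉ₛ q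
x∈p─q⇒x∉q (s ∷ p) (true ∷ q)  (there x∈) (there x∈q) = x∈p─q⇒x∉q p q x∈ x∈q
x∈p─q⇒x∉q (s ∷ p) (false ∷ q) (there x∈) (there x∈q) = x∈p─q⇒x∉q p q x∈ x∈q

∪⁅⁆-⊆ : ∀ {X Y : Subset n} {a} → X ⊆ Y → a ∈ₛ Y → X ∪ ⁅ a ⁆ ⊆ Y
∪⁅⁆-⊆ {X = X} {a = a} X⊆Y a∈Y x∈ with x∈p∪q⁻ X ⁅ a ⁆ x∈
... | inj₁ x∈X   = X⊆Y x∈X
... | inj₂ x∈⁅a⁆ = subst (_∈ₛ _) (sym (x∈⁅y⁆⇒x≡y a x∈⁅a⁆)) a∈Y

⊆-∣─∣≡0 : ∀ {X Y : Subset n} → X ⊆ Y → ∣ Y ─ X ∣ ≡ 0 → X ≡ Y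
⊆-∣─∣≡0 {X = X} {Y} X⊆Y ∣Y─X∣≡0 = ⊆-antisym X⊆Y Y⊆X
  where
  Y⊆X : Y ⊆ X
  Y⊆X {x} x∈Y with x ∈? X
  ... | yes x∈X = x∈X
  ... | no  x∉X = contradiction (subst (∣ (Y ─ X) - x ∣ <_) ∣Y─X∣≡0 (x∈p⇒∣p-x∣<∣p∣ (x∈p∧x∉q⇒x∈p─q x∈Y x∉X))) (λ ())

full─p≡∁p : (p : Subset n) → full ─ p ≡ ∁ p
full─p≡∁p []          = refl
full─p≡∁p (true ∷ p)  = cong (false ∷_) (full─p≡∁p p)
full─p≡∁p (false ∷ p) = cong (true ∷_) (full─p≡∁p p)

∣full─p∣ : (p : Subset n) → ∣ full ─ p ∣ ≡ n ∸ ∣ p ∣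
∣full─p∣ p = trans (cong ∣_∣ (full─p≡∁p p)) (∣∁p∣≡n∸∣p∣ p)

chainSum : Subset n → Subset n → (List (Subset n) → ℕ) → ℕ
chainSum X Y g = ∑[ σ ← perms (elems (Y ─ X)) ] g (chainFrom X σ)

chainSum-maxChains : (X Y : Subset n) (g : List (Subset n) → ℕ) → ∑ (maxChains X Y) g ≡ chainSum X Y g
chainSum-maxChains X Y g = ∑-map (chainFrom X) (perms (elems (Y ─ X))) g

∣─∪⁅⁆∣ : (X Y : Subset n) {a : Fin n} → a ∈ₛ Y ─ X → suc ∣ Y ─ (X ∪ ⁅ a ⁆) ∣ ≡ ∣ Y ─ X ∣
∣─∪⁅⁆∣ X Y {a} a∈ = trans (cong (λ Z → suc ∣ Z ∣) (sym (p─q─r≡p─q∪r Y X ⁅ a ⁆))) (∣-∣-remove (Y ─ X) a∈)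

∣-─∣ : (X Y : Subset n) {a : Fin n} → a ∈ₛ Y ─ X → suc ∣ (Y - a) ─ X ∣ ≡ ∣ Y ─ X ∣
∣-─∣ X Y {a} a∈ = trans (cong (λ Z → suc ∣ Z ∣) (p─q─r≡p─r─q Y ⁅ a ⁆ X)) (∣-∣-remove (Y ─ X) a∈)

missing : Subset n → ℕ
missing X = ∣ full ─ X ∣

missing-∪ : ∀ (X : Subset n) {a} → a ∈ elems (full ─ X) → missing (X ∪ ⁅ a ⁆) < missing X
missing-∪ X a∈ = ≤-reflexive (∣─∪⁅⁆∣ X full (elems-sound (full ─ X) a∈))

missing-wf : WellFounded (_<_ on missing {n})
missing-wf = On.wellFounded missing <-wellFounded

chainSum-single : (X Y : Subset n) (g : List (Subset n) → ℕ) → ∣ Y ─ X ∣ ≡ 0 → chainSum X Y g ≡ g (X ∷ [])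
chainSum-single X Y g ∣Y─X∣≡0 = trans (cong (λ E → ∑[ σ ← perms E ] g (chainFrom X σ)) (elems-empty (Y ─ X) ∣Y─X∣≡0))
  (+-identityʳ (g (X ∷ [])))

chainSum-first : (X Y : Subset n) (g : List (Subset n) → ℕ) {k : ℕ} → ∣ Y ─ X ∣ ≡ suc k →
  chainSum X Y g ≡ ∑[ a ← elems (Y ─ X) ] chainSum (X ∪ ⁅ a ⁆) Y (λ c → g (X ∷ c))
chainSum-first {n} X Y g ∣Y─X∣≡1+k with elems-nonempty (Y ─ X) ∣Y─X∣≡1+k
... | e , es , E≡ = begin
    chainSum X Y g
  ≡⟨ cong (λ E → ∑ (perms E) h) E≡ ⟩
    ∑ (perms (e ∷ es)) h
  ≡⟨ perms-first e es h ⟩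
    ∑[ p ← select (e ∷ es) ] ∑[ τ ← perms (proj₂ p) ] h (proj₁ p ∷ τ)
  ≡⟨ cong (λ E → ∑[ p ← select E ] ∑[ τ ← perms (proj₂ p) ] h (proj₁ p ∷ τ)) (sym E≡) ⟩
    ∑[ p ← select (elems (Y ─ X)) ] ∑[ τ ← perms (proj₂ p) ] h (proj₁ p ∷ τ)
  ≡⟨ cong (λ s → ∑[ p ← s ] ∑[ τ ← perms (proj₂ p) ] h (proj₁ p ∷ τ)) (select-elems (Y ─ X)) ⟩
    ∑[ p ← map (λ a → a , elems ((Y ─ X) - a)) (elems (Y ─ X)) ] ∑[ τ ← perms (proj₂ p) ] h (proj₁ p ∷ τ)
  ≡⟨ ∑-map _ (elems (Y ─ X)) _ ⟩
    ∑[ a ← elems (Y ─ X) ] ∑[ τ ← perms (elems ((Y ─ X) - a)) ] g (X ∷ chainFrom (X ∪ ⁅ a ⁆) τ)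
  ≡⟨ ∑-cong (elems (Y ─ X)) (λ a → cong (λ Z → ∑[ τ ← perms (elems Z) ] g (X ∷ chainFrom (X ∪ ⁅ a ⁆) τ))
                                        (p─q─r≡p─q∪r Y X ⁅ a ⁆)) ⟩
    ∑[ a ← elems (Y ─ X) ] chainSum (X ∪ ⁅ a ⁆) Y (λ c → g (X ∷ c))
  ∎
  where
  open ≡-Reasoning
  h : List (Fin n) → ℕ
  h σ = g (chainFrom X σ)

-- Proved from the first-step decomposition
-- by induction, exchanging the first and the last added element.
chainSum-last : (X Y : Subset n) (g : List (Subset n) → ℕ) {k : ℕ} → X ⊆ Y → ∣ Y ─ X ∣ ≡ suc k →
  chainSum X Y g ≡ ∑[ b ← elems (Y ─ X) ] chainSum X (Y - b) (λ c → g (c ∷ʳ Y))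
chainSum-last X Y g {zero} X⊆Y ∣Y─X∣≡1 = trans (chainSum-first X Y g ∣Y─X∣≡1) (∑-cong∈ (elems (Y ─ X)) one-step)
  where
  one-step : ∀ a → a ∈ elems (Y ─ X) → chainSum (X ∪ ⁅ a ⁆) Y (λ c → g (X ∷ c)) ≡ chainSum X (Y - a) (λ c → g (c ∷ʳ Y))
  one-step a a∈ = trans (chainSum-single (X ∪ ⁅ a ⁆) Y (λ c → g (X ∷ c)) done)
    (trans (cong (λ Z → g (X ∷ Z ∷ [])) X∪a≡Y)
      (sym (chainSum-single X (Y - a) (λ c → g (c ∷ʳ Y)) (suc-injective (trans (∣-─∣ X Y (elems-sound (Y ─ X) a∈)) ∣Y─X∣≡1)))))
    where
    done : ∣ Y ─ (X ∪ ⁅ a ⁆) ∣ ≡ 0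
    done = suc-injective (trans (∣─∪⁅⁆∣ X Y (elems-sound (Y ─ X) a∈)) ∣Y─X∣≡1)
    X∪a≡Y : X ∪ ⁅ a ⁆ ≡ Y
    X∪a≡Y = ⊆-∣─∣≡0 (∪⁅⁆-⊆ X⊆Y (p─q⊆p Y X (elems-sound (Y ─ X) a∈))) done
chainSum-last {n} X Y g {suc k} X⊆Y ∣Y─X∣≡2+k = begin
    chainSum X Y g
  ≡⟨ chainSum-first X Y g ∣Y─X∣≡2+k ⟩
    ∑[ a ← E ] chainSum (X ∪ ⁅ a ⁆) Y (λ c → g (X ∷ c))
  ≡⟨ ∑-cong∈ E (λ a a∈ → trans
       (chainSum-last (X ∪ ⁅ a ⁆) Y (λ c → g (X ∷ c)) (∪⁅⁆-⊆ X⊆Y (p─q⊆p Y X (elems-sound (Y ─ X) a∈)))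
         (suc-injective (trans (∣─∪⁅⁆∣ X Y (elems-sound (Y ─ X) a∈)) ∣Y─X∣≡2+k)))
       (cong (λ Z → ∑[ b ← elems Z ] Φ a b) (sym (p─q─r≡p─q∪r Y X ⁅ a ⁆)))) ⟩
    ∑[ a ← E ] ∑[ b ← elems ((Y ─ X) - a) ] Φ a b
  ≡⟨ ∑-pairs-swap (Y ─ X) Φ ⟩
    ∑[ b ← E ] ∑[ a ← elems ((Y ─ X) - b) ] Φ a b
  ≡⟨ ∑-cong∈ E (λ b b∈ → sym (trans
       (chainSum-first X (Y - b) (λ c → g (c ∷ʳ Y)) (suc-injective (trans (∣-─∣ X Y (elems-sound (Y ─ X) b∈)) ∣Y─X∣≡2+k)))
       (cong (λ Z → ∑[ a ← elems Z ] Φ a b) (p─q─r≡p─r─q Y ⁅ b ⁆ X)))) ⟩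
    ∑[ b ← E ] chainSum X (Y - b) (λ c → g (c ∷ʳ Y))
  ∎
  where
  open ≡-Reasoning
  E : List (Fin n)
  E = elems (Y ─ X)
  Φ : Fin n → Fin n → ℕ
  Φ a b = chainSum (X ∪ ⁅ a ⁆) (Y - b) (λ c → g (X ∷ (c ∷ʳ Y)))

chainCount : (X Y : Subset n) → chainSum X Y (λ _ → 1) ≡ ∣ Y ─ X ∣ !
chainCount {n} X Y = count refl
  where
  count : ∀ {X} {k} → ∣ Y ─ X ∣ ≡ k → chainSum X Y (λ _ → 1) ≡ k !
  count {X} {zero}  ∣Y─X∣≡0   = chainSum-single X Y _ ∣Y─X∣≡0
  count {X} {suc k} ∣Y─X∣≡1+k = begin
      chainSum X Y (λ _ → 1)
    ≡⟨ chainSum-first X Y _ ∣Y─X∣≡1+k ⟩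
      ∑[ a ← E ] chainSum (X ∪ ⁅ a ⁆) Y (λ _ → 1)
    ≡⟨ ∑-cong∈ E (λ a a∈ → count (suc-injective (trans (∣─∪⁅⁆∣ X Y (elems-sound (Y ─ X) a∈)) ∣Y─X∣≡1+k))) ⟩
      ∑[ _ ← E ] (k !)
    ≡⟨ ∑-const E (k !) ⟩
      length E * k !
    ≡⟨ cong (_* k !) (trans (length-elems (Y ─ X)) ∣Y─X∣≡1+k) ⟩
      suc k !
    ∎
    where
    open ≡-Reasoning
    E : List (Fin n)
    E = elems (Y ─ X)

chainCount-nonZero : (X Y : Subset n) → NonZero (chainSum X Y (λ _ → 1))
chainCount-nonZero X Y = subst NonZero (sym (chainCount X Y)) (∣ Y ─ X ∣ !≢0)

chainCount-full : chainSum ∅ (full {n}) (λ _ → 1) ≡ n !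
chainCount-full {n} = trans (chainCount (∅ {n}) full) (cong _! (trans (∣full─p∣ (∅ {n})) (cong (n ∸_) (∣⊥∣≡0 n))))

chainSum-starts : (X Y : Subset n) {g g′ : List (Subset n) → ℕ} →
  (∀ c → g (X ∷ c) ≡ g′ (X ∷ c)) → chainSum X Y g ≡ chainSum X Y g′
chainSum-starts X Y {g} {g′} g≡g′ = ∑-cong (perms (elems (Y ─ X))) starts
  where
  starts : ∀ σ → g (chainFrom X σ) ≡ g′ (chainFrom X σ)
  starts []      = g≡g′ []
  starts (a ∷ σ) = g≡g′ (chainFrom (X ∪ ⁅ a ⁆) σ)

chainSum-ends : (X Y : Subset n) {g g′ : List (Subset n) → ℕ} → X ⊆ Y →
  (∀ c → g (c ∷ʳ Y) ≡ g′ (c ∷ʳ Y)) → chainSum X Y g ≡ chainSum X Y g′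
chainSum-ends X Y {g} {g′} X⊆Y g≡g′ with ∣ Y ─ X ∣ in ∣Y─X∣≡k
... | zero  = trans (chainSum-single X Y g ∣Y─X∣≡k)
    (trans (cong (λ Z → g (Z ∷ [])) X≡Y) (trans (g≡g′ []) (trans (cong (λ Z → g′ (Z ∷ [])) (sym X≡Y))
      (sym (chainSum-single X Y g′ ∣Y─X∣≡k)))))
  where
  X≡Y : X ≡ Y
  X≡Y = ⊆-∣─∣≡0 X⊆Y ∣Y─X∣≡k
... | suc k = trans (chainSum-last X Y g X⊆Y ∣Y─X∣≡k)
    (trans (∑-cong (elems (Y ─ X)) (λ b → ∑-cong (perms (elems ((Y - b) ─ X))) (λ σ → g≡g′ (chainFrom X σ))))
      (sym (chainSum-last X Y g′ X⊆Y ∣Y─X∣≡k)))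

chainSum-skip-first : (X Y : Subset n) (g : List (Subset n) → ℕ) → (∀ c → g (X ∷ c) ≡ g c) → g [] ≡ 0 →
  chainSum X Y g ≡ ∑[ a ← elems (Y ─ X) ] chainSum (X ∪ ⁅ a ⁆) Y g
chainSum-skip-first X Y g skip g[]≡0 with ∣ Y ─ X ∣ in ∣Y─X∣≡k
... | zero  = trans (chainSum-single X Y g ∣Y─X∣≡k) (trans (skip []) (trans g[]≡0
    (cong (λ E → ∑[ a ← E ] chainSum (X ∪ ⁅ a ⁆) Y g) (sym (elems-empty (Y ─ X) ∣Y─X∣≡k)))))
... | suc k = trans (chainSum-first X Y g ∣Y─X∣≡k)
    (∑-cong (elems (Y ─ X)) (λ a → ∑-cong (perms (elems (Y ─ (X ∪ ⁅ a ⁆)))) (λ σ → skip (chainFrom (X ∪ ⁅ a ⁆) σ))))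

chainSum-skip-last : (X Y : Subset n) (g : List (Subset n) → ℕ) → X ⊆ Y → (∀ c → g (c ∷ʳ Y) ≡ g c) → g [] ≡ 0 →
  chainSum X Y g ≡ ∑[ b ← elems (Y ─ X) ] chainSum X (Y - b) g
chainSum-skip-last X Y g X⊆Y skip g[]≡0 with ∣ Y ─ X ∣ in ∣Y─X∣≡k
... | zero  = trans (chainSum-single X Y g ∣Y─X∣≡k)
    (trans (cong (λ Z → g (Z ∷ [])) (⊆-∣─∣≡0 X⊆Y ∣Y─X∣≡k)) (trans (skip []) (trans g[]≡0
      (cong (λ E → ∑[ b ← E ] chainSum X (Y - b) g) (sym (elems-empty (Y ─ X) ∣Y─X∣≡k))))))
... | suc k = trans (chainSum-last X Y g X⊆Y ∣Y─X∣≡k)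
    (∑-cong (elems (Y ─ X)) (λ b → ∑-cong (perms (elems ((Y - b) ─ X))) (λ σ → skip (chainFrom X σ))))

hits : Family n → List (Subset n) → ℕ
hits F c = ind (any F c)

module _ (F : Family n) where

  countOn-skip-head : ∀ {X} → F X ≡ false → ∀ c → countOn F (X ∷ c) ≡ countOn F c
  countOn-skip-head X∉F c rewrite X∉F = refl

  countOn-skip-last : ∀ {Y} → F Y ≡ false → ∀ c → countOn F (c ∷ʳ Y) ≡ countOn F c
  countOn-skip-last Y∉F []      rewrite Y∉F = refl
  countOn-skip-last Y∉F (x ∷ c) with F x
  ... | true  = cong suc (countOn-skip-last Y∉F c)
  ... | false = countOn-skip-last Y∉F c

  private
    any-∷ʳ : ∀ c Y → any F (c ∷ʳ Y) ≡ any F c ∨ F Y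
    any-∷ʳ []      Y with F Y
    ... | true  = refl
    ... | false = refl
    any-∷ʳ (x ∷ c) Y with F x
    ... | true  = refl
    ... | false = any-∷ʳ c Y

  hits-skip-head : ∀ {X} → F X ≡ false → ∀ c → hits F (X ∷ c) ≡ hits F c
  hits-skip-head X∉F c rewrite X∉F = refl

  hits-skip-last : ∀ {Y} → F Y ≡ false → ∀ c → hits F (c ∷ʳ Y) ≡ hits F c
  hits-skip-last {Y} Y∉F c rewrite any-∷ʳ c Y | Y∉F with any F c
  ... | true  = refl
  ... | false = refl

  hits-head : ∀ {X} → F X ≡ true → ∀ c → hits F (X ∷ c) ≡ 1
  hits-head X∈F c rewrite X∈F = refl

  hits-last : ∀ {Y} → F Y ≡ true → ∀ c → hits F (c ∷ʳ Y) ≡ 1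
  hits-last {Y} Y∈F c rewrite any-∷ʳ c Y | Y∈F with any F c
  ... | true  = refl
  ... | false = refl

-- States x carry totals G x ("number of F-sets on all
-- chains from x"), H x ("number of chains from x meeting F") and L x ("number of chains from
-- x").  Outside F the chains from x split into those from the states next x, so G and H are
-- additive there; inside F every chain meets F, so H x = L x.
module BestRatio {S : Set} (inF : S → Bool) (next : S → List S) (rank : S → ℕ)
    (next-rank : ∀ {x y} → y ∈ next x → rank y < rank x)
    (G H L : S → ℕ)
    (H≡L-inside : ∀ x → inF x ≡ true → H x ≡ L x)
    (G-outside : ∀ x → inF x ≡ false → G x ≡ ∑ (next x) G)
    (H-outside : ∀ x → inF x ≡ false → H x ≡ ∑ (next x) H)
    where

  propagate : (A* : S) → (∀ x → inF x ≡ true → G x * L A* ≤ G A* * L x) →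
    ∀ x → G x * L A* ≤ G A* * H x
  propagate A* A*-best x = go x (On.wellFounded rank <-wellFounded x)
    where
    go : ∀ x → Acc (_<_ on rank) x → G x * L A* ≤ G A* * H x
    go x (acc rec) with inF x in x∈F
    ... | true  = subst (λ h → G x * L A* ≤ G A* * h) (sym (H≡L-inside x x∈F)) (A*-best x x∈F)
    ... | false = begin
        G x * L A*
      ≡⟨ cong (_* L A*) (G-outside x x∈F) ⟩
        ∑ (next x) G * L A*
      ≡⟨ ∑-*ʳ (next x) (L A*) G ⟨
        ∑[ y ← next x ] (G y * L A*)
      ≤⟨ ∑-mono∈ (next x) (λ y y∈ → go y (rec (next-rank y∈))) ⟩
        ∑[ y ← next x ] (G A* * H y)
      ≡⟨ ∑-*ˡ (next x) (G A*) H ⟩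
        G A* * ∑ (next x) H
      ≡⟨ cong (G A* *_) (H-outside x x∈F) ⟨
        G A* * H x
      ∎
      where open ≤-Reasoning

allSubsets-complete : ∀ n (B : Subset n) → B ∈ allSubsets n
allSubsets-complete zero    []          = here refl
allSubsets-complete (suc n) (true ∷ B)  = ∈-++⁺ˡ (∈-map⁺ (true ∷_) (allSubsets-complete n B))
allSubsets-complete (suc n) (false ∷ B) =
  ∈-++⁺ʳ (map (true ∷_) (allSubsets n)) (∈-map⁺ (false ∷_) (allSubsets-complete n B))

_≟ˢ_ : DecidableEquality (Subset n)
_≟ˢ_ = ≡-dec Bool._≟_

δ : Subset n → Subset n → ℕ
δ A B = ind (does (A ≟ˢ B))

∑-δ : ∀ n (w : Subset n → ℕ) (B : Subset n) → ∑[ A ← allSubsets n ] (w A * δ A B) ≡ w B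
∑-δ zero    w []          = trans (+-identityʳ _) (*-identityʳ (w []))
∑-δ (suc n) w (true ∷ B)  = begin
    ∑[ A ← map (true ∷_) (allSubsets n) ++ map (false ∷_) (allSubsets n) ] (w A * δ A (true ∷ B))
  ≡⟨ ∑-++ (map (true ∷_) (allSubsets n)) _ _ ⟩
    ∑[ A ← map (true ∷_) (allSubsets n) ] (w A * δ A (true ∷ B))
      + ∑[ A ← map (false ∷_) (allSubsets n) ] (w A * δ A (true ∷ B))
  ≡⟨ cong₂ _+_ (trans (∑-map _ (allSubsets n) _) (∑-δ n (λ A → w (true ∷ A)) B))
               (trans (∑-map _ (allSubsets n) _) (∑-zero (allSubsets n) (λ A _ → *-zeroʳ (w (false ∷ A))))) ⟩
    w (true ∷ B) + 0
  ≡⟨ +-identityʳ _ ⟩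
    w (true ∷ B)
  ∎
  where open ≡-Reasoning
∑-δ (suc n) w (false ∷ B) = begin
    ∑[ A ← map (true ∷_) (allSubsets n) ++ map (false ∷_) (allSubsets n) ] (w A * δ A (false ∷ B))
  ≡⟨ ∑-++ (map (true ∷_) (allSubsets n)) _ _ ⟩
    ∑[ A ← map (true ∷_) (allSubsets n) ] (w A * δ A (false ∷ B))
      + ∑[ A ← map (false ∷_) (allSubsets n) ] (w A * δ A (false ∷ B))
  ≡⟨ cong₂ _+_ (trans (∑-map _ (allSubsets n) _) (∑-zero (allSubsets n) (λ A _ → *-zeroʳ (w (true ∷ A)))))
               (trans (∑-map _ (allSubsets n) _) (∑-δ n (λ A → w (false ∷ A)) B)) ⟩
    w (false ∷ B)
  ∎
  where open ≡-Reasoning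

occurrences : Subset n → List (Subset n) → ℕ
occurrences A c = ∑[ B ← c ] δ A B

countOn-by-sets : (F : Family n) (c : List (Subset n)) →
  countOn F c ≡ ∑[ A ← allSubsets n ] (ind (F A) * occurrences A c)
countOn-by-sets {n} F c = begin
    countOn F c
  ≡⟨ length-filter F c ⟩
    ∑[ B ← c ] ind (F B)
  ≡⟨ ∑-cong c (λ B → sym (∑-δ n (λ A → ind (F A)) B)) ⟩
    ∑[ B ← c ] ∑[ A ← allSubsets n ] (ind (F A) * δ A B)
  ≡⟨ ∑-swap c (allSubsets n) (λ B A → ind (F A) * δ A B) ⟩
    ∑[ A ← allSubsets n ] ∑[ B ← c ] (ind (F A) * δ A B)
  ≡⟨ ∑-cong (allSubsets n) (λ A → ∑-*ˡ c (ind (F A)) (δ A)) ⟩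
    ∑[ A ← allSubsets n ] (ind (F A) * occurrences A c)
  ∎
  where open ≡-Reasoning

count-members : (X A : Subset n) → ∑[ a ← elems (full ─ X) ] ind (does (a ∈? A)) ≡ ∣ A ─ X ∣
count-members []          []          = refl
count-members (true ∷ X)  (y ∷ A)     = trans (∑-map suc (elems (full ─ X)) _) (count-members X A)
count-members (false ∷ X) (true ∷ A)  = cong suc (trans (∑-map suc (elems (full ─ X)) _) (count-members X A))
count-members (false ∷ X) (false ∷ A) = trans (∑-map suc (elems (full ─ X)) _) (count-members X A)

private
  ⊈-∪ : ∀ {X A : Subset n} a → ¬ X ⊆ A → ¬ X ∪ ⁅ a ⁆ ⊆ A
  ⊈-∪ a X⊈A X∪a⊆A = X⊈A (λ x∈ → X∪a⊆A (p⊆p∪q ⁅ a ⁆ x∈))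

  ∉-∪ : ∀ {X A : Subset n} {a} → a ∉ₛ A → ¬ X ∪ ⁅ a ⁆ ⊆ A
  ∉-∪ {X = X} {a = a} a∉A X∪a⊆A = a∉A (X∪a⊆A (q⊆p∪q X ⁅ a ⁆ (x∈⁅x⁆ a)))


module Through (A : Subset n) where

  -- through X counts the chains from X to [n] through A (which pass it at most once).
  through : Subset n → ℕ
  through X = chainSum X full (occurrences A)

  L : ℕ
  L = chainSum A full (λ _ → 1)

  through-step : ∀ X → A ≢ X → through X ≡ ∑[ a ← elems (full ─ X) ] through (X ∪ ⁅ a ⁆)
  through-step X A≢X = chainSum-skip-first X full (occurrences A) skip refl
    where
    skip : ∀ c → occurrences A (X ∷ c) ≡ occurrences A c
    skip c = cong (λ b → ind b + occurrences A c) (dec-false (A ≟ˢ X) A≢X)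

  through-outside : ∀ X → ¬ X ⊆ A → through X ≡ 0
  through-outside X = go X (missing-wf X)
    where
    go : ∀ X → Acc (_<_ on missing) X → ¬ X ⊆ A → through X ≡ 0
    go X (acc rec) X⊈A = trans (through-step X (λ A≡X → X⊈A (subst (_⊆ A) A≡X ⊆-refl)))
      (∑-zero (elems (full ─ X)) (λ a a∈ → go (X ∪ ⁅ a ⁆) (rec (missing-∪ X a∈)) (⊈-∪ a X⊈A)))

  through-self : through A ≡ L
  through-self with ∣ full ─ A ∣ in ∣full─A∣≡k
  ... | zero  = trans (chainSum-single A full (occurrences A) ∣full─A∣≡k)
      (trans (cong (λ b → ind b + 0) (dec-true (A ≟ˢ A) refl)) (sym (chainSum-single A full (λ _ → 1) ∣full─A∣≡k)))
  ... | suc k = begin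
      through A
    ≡⟨ chainSum-first A full (occurrences A) ∣full─A∣≡k ⟩
      ∑[ a ← E ] chainSum (A ∪ ⁅ a ⁆) full (λ c → ind (does (A ≟ˢ A)) + occurrences A c)
    ≡⟨ ∑-cong∈ E term ⟩
      ∑[ a ← E ] chainSum (A ∪ ⁅ a ⁆) full (λ _ → 1)
    ≡⟨ chainSum-first A full (λ _ → 1) ∣full─A∣≡k ⟨
      L
    ∎
    where
    open ≡-Reasoning
    E : List (Fin n)
    E = elems (full ─ A)
    -- After the first step the chain has left A for good, and only its head A is counted.
    term : ∀ a → a ∈ E → chainSum (A ∪ ⁅ a ⁆) full (λ c → ind (does (A ≟ˢ A)) + occurrences A c)
                         ≡ chainSum (A ∪ ⁅ a ⁆) full (λ _ → 1)
    term a a∈ = begin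
        chainSum (A ∪ ⁅ a ⁆) full (λ c → ind (does (A ≟ˢ A)) + occurrences A c)
      ≡⟨ ∑-cong Π (λ σ → cong (λ b → ind b + occurrences A (chainFrom (A ∪ ⁅ a ⁆) σ)) (dec-true (A ≟ˢ A) refl)) ⟩
        chainSum (A ∪ ⁅ a ⁆) full (λ c → 1 + occurrences A c)
      ≡⟨ ∑-+ Π (λ _ → 1) (λ σ → occurrences A (chainFrom (A ∪ ⁅ a ⁆) σ)) ⟩
        chainSum (A ∪ ⁅ a ⁆) full (λ _ → 1) + through (A ∪ ⁅ a ⁆)
      ≡⟨ cong (chainSum (A ∪ ⁅ a ⁆) full (λ _ → 1) +_)
              (through-outside (A ∪ ⁅ a ⁆) (∉-∪ (x∈p─q⇒x∉q full A (elems-sound (full ─ A) a∈)))) ⟩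
        chainSum (A ∪ ⁅ a ⁆) full (λ _ → 1) + 0
      ≡⟨ +-identityʳ _ ⟩
        chainSum (A ∪ ⁅ a ⁆) full (λ _ → 1)
      ∎
      where
      Π : List (List (Fin n))
      Π = perms (elems (full ─ (A ∪ ⁅ a ⁆)))

  -- From X ⊆ A, the chains through A are the orderings of A ∖ X followed by a chain from A.
  through-below : ∀ X → X ⊆ A → through X ≡ ∣ A ─ X ∣ ! * L
  through-below X = go X (missing-wf X)
    where
    go : ∀ X → Acc (_<_ on missing) X → X ⊆ A → through X ≡ ∣ A ─ X ∣ ! * L
    go X (acc rec) X⊆A with A ≟ˢ X
    ... | yes refl = trans through-self (sym (trans (cong (λ m → m ! * L) ∣A─A∣≡0) (+-identityʳ L)))
      where
      ∣A─A∣≡0 : ∣ A ─ A ∣ ≡ 0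
      ∣A─A∣≡0 = trans (cong ∣_∣ (Empty-unique (λ (x , x∈) → x∈p─q⇒x∉q A A x∈ (p─q⊆p A A x∈)))) (∣⊥∣≡0 n)
    ... | no A≢X with ∣ A ─ X ∣ in ∣A─X∣≡k
    ...   | zero  = contradiction (sym (⊆-∣─∣≡0 X⊆A ∣A─X∣≡k)) A≢X
    ...   | suc d = begin
        through X
      ≡⟨ through-step X A≢X ⟩
        ∑[ a ← E ] through (X ∪ ⁅ a ⁆)
      ≡⟨ ∑-cong∈ E term ⟩
        ∑[ a ← E ] (ind (does (a ∈? A)) * (d ! * L))
      ≡⟨ ∑-*ʳ E (d ! * L) _ ⟩
        ∑[ a ← E ] ind (does (a ∈? A)) * (d ! * L)
      ≡⟨ cong (_* (d ! * L)) (trans (count-members X A) ∣A─X∣≡k) ⟩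
        suc d * (d ! * L)
      ≡⟨ *-assoc (suc d) (d !) L ⟨
        suc d ! * L
      ∎
      where
      open ≡-Reasoning
      E : List (Fin n)
      E = elems (full ─ X)
      term : ∀ a → a ∈ E → through (X ∪ ⁅ a ⁆) ≡ ind (does (a ∈? A)) * (d ! * L)
      term a a∈ with a ∈? A
      ... | no  a∉A = through-outside (X ∪ ⁅ a ⁆) (∉-∪ a∉A)
      ... | yes a∈A = trans (go (X ∪ ⁅ a ⁆) (rec (missing-∪ X a∈)) (∪⁅⁆-⊆ X⊆A a∈A))
          (trans (cong (λ m → m ! * L) ∣A─X∪a∣≡d) (sym (+-identityʳ _)))
        where
        a∉X : a ∉ₛ X
        a∉X = x∈p─q⇒x∉q full X (elems-sound (full ─ X) a∈)
        ∣A─X∪a∣≡d : ∣ A ─ (X ∪ ⁅ a ⁆) ∣ ≡ d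
        ∣A─X∪a∣≡d = suc-injective (trans (∣─∪⁅⁆∣ X A (x∈p∧x∉q⇒x∈p─q a∈A a∉X)) ∣A─X∣≡k)

  chains-through : through ∅ ≡ ∣ A ∣ ! * (n ∸ ∣ A ∣) !
  chains-through = trans (through-below ∅ (⊆-min A))
    (cong₂ (λ p q → p ! * q) (cong ∣_∣ (p─⊥≡p A))
      (trans (chainCount A full) (cong _! (∣full─p∣ A))))

binomial : ∀ {n k} → k ≤ n → n ! ≡ (n C k) * (k ! * (n ∸ k) !)
binomial {n} {k} k≤n = sym (trans (cong (_* (k ! * (n ∸ k) !)) (nCk≡n!/k![n-k]! k≤n))
  (m/n*n≡m {{k !* (n ∸ k) !≢0}} (k![n∸k]!∣n! k≤n)))

F-sets-on-chains : (F : Family n) →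
  chainSum ∅ full (countOn F) ≡ ∑[ A ← allSubsets n ] (ind (F A) * (∣ A ∣ ! * (n ∸ ∣ A ∣) !))
F-sets-on-chains {n} F = begin
    chainSum ∅ full (countOn F)
  ≡⟨ ∑-cong Π (λ σ → countOn-by-sets F (chain σ)) ⟩
    ∑[ σ ← Π ] ∑[ A ← allSubsets n ] (ind (F A) * occurrences A (chain σ))
  ≡⟨ ∑-swap Π (allSubsets n) _ ⟩
    ∑[ A ← allSubsets n ] ∑[ σ ← Π ] (ind (F A) * occurrences A (chain σ))
  ≡⟨ ∑-cong (allSubsets n) (λ A → trans (∑-*ˡ Π (ind (F A)) _) (cong (ind (F A) *_) (Through.chains-through A))) ⟩
    ∑[ A ← allSubsets n ] (ind (F A) * (∣ A ∣ ! * (n ∸ ∣ A ∣) !))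
  ∎
  where
  open ≡-Reasoning
  Π : List (List (Fin n))
  Π = perms (elems (full {n} ─ ∅))
  chain : List (Fin n) → List (Subset n)
  chain = chainFrom ∅

ℓ-times-n! : (F : Family n) → ℓ F ℚ.* ι (n !) ≡ ι (chainSum ∅ full (countOn F))
ℓ-times-n! {n} F = begin
    ℓ F ℚ.* ι (n !)
  ≡⟨ sumℚ-*ʳ _ (filterᵇ F (allSubsets n)) (ι (n !)) ⟩
    sumℚ (map (λ A → (ι 1 ÷' ι (n C ∣ A ∣)) ℚ.* ι (n !)) (filterᵇ F (allSubsets n)))
  ≡⟨ sumℚ-cong (filterᵇ F (allSubsets n)) weight ⟩
    sumℚ (map (λ A → ι (∣ A ∣ ! * (n ∸ ∣ A ∣) !)) (filterᵇ F (allSubsets n)))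
  ≡⟨ sumℚ-ι (λ A → ∣ A ∣ ! * (n ∸ ∣ A ∣) !) (filterᵇ F (allSubsets n)) ⟩
    ι (sum (map (λ A → ∣ A ∣ ! * (n ∸ ∣ A ∣) !) (filterᵇ F (allSubsets n))))
  ≡⟨ cong ι (trans (sum-map _ (filterᵇ F (allSubsets n))) (trans (∑-filter F (allSubsets n) _) (sym (F-sets-on-chains F)))) ⟩
    ι (chainSum ∅ full (countOn F))
  ∎
  where
  open ≡-Reasoning
  -- The weight 1/(n choose ∣A∣) of A, scaled by n!, is the number of chains through A.
  weight : ∀ A → (ι 1 ÷' ι (n C ∣ A ∣)) ℚ.* ι (n !) ≡ ι (∣ A ∣ ! * (n ∸ ∣ A ∣) !)
  weight A = begin
      (ι 1 ÷' ι c) ℚ.* ι (n !)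
    ≡⟨ cong (λ m → (ι 1 ÷' ι c) ℚ.* ι m) n!≡cP ⟩
      (ι 1 ÷' ι c) ℚ.* ι (c * P)
    ≡⟨ cong ((ι 1 ÷' ι c) ℚ.*_) (ι-* c P) ⟩
      (ι 1 ÷' ι c) ℚ.* (ι c ℚ.* ι P)
    ≡⟨ ℚ.*-assoc (ι 1 ÷' ι c) (ι c) (ι P) ⟨
      (ι 1 ÷' ι c) ℚ.* ι c ℚ.* ι P
    ≡⟨ cong (ℚ._* ι P) (÷'-inverse (ι 1) (ι c) (ι-≢0 c {{c≢0}})) ⟩
      ℚ.1ℚ ℚ.* ι P
    ≡⟨ ℚ.*-identityˡ (ι P) ⟩
      ι P
    ∎
    where
    c P : ℕ
    c = n C ∣ A ∣
    P = ∣ A ∣ ! * (n ∸ ∣ A ∣) !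
    n!≡cP : n ! ≡ c * P
    n!≡cP = binomial (∣p∣≤n A)
    c≢0 : NonZero c
    c≢0 = m*n≢0⇒m≢0 c {P} {{subst NonZero n!≡cP (n !≢0)}}

ℓ-by-chains : (F : Family n) → ℓ F ≡ ι (chainSum ∅ full (countOn F)) ÷' ι (n !)
ℓ-by-chains {n} F = ÷'-unique _ (ι (n !)) (ℓ F) (ι-≢0 (n !) {{n !≢0}}) (ℓ-times-n! F)

ℓI-by-chains : (F : Family n) (X Y : Subset n) →
  ℓI F X Y ≡ ι (chainSum X Y (countOn F)) ÷' ι (chainSum X Y (λ _ → 1))
ℓI-by-chains F X Y = cong₂ (λ a b → ι a ÷' ι b)
  (trans (sum-map (countOn F) (maxChains X Y)) (chainSum-maxChains X Y (countOn F)))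
  (trans (length≡∑1 (maxChains X Y)) (chainSum-maxChains X Y (λ _ → 1)))

hitProb-by-chains : (F : Family n) → hitProb F ≡ ι (chainSum ∅ full (hits F)) ÷' ι (n !)
hitProb-by-chains {n} F = cong₂ (λ a b → ι a ÷' ι b)
  (trans (length-filter (any F) (maxChains (∅ {n}) full)) (chainSum-maxChains ∅ full (hits F)))
  (trans (length≡∑1 (maxChains (∅ {n}) full)) (trans (chainSum-maxChains (∅ {n}) full (λ _ → 1)) (chainCount-full {n})))

module Choice (F : Family n) (B : Subset n) (B∈F : T (F B))
              (G L : Subset n → ℕ) (L≢0 : ∀ A → NonZero (L A)) where

  ratio : Subset n → ℚ.ℚ
  ratio A = ι (G A) ÷' ι (L A)

  inF : List (Subset n)
  inF = filterᵇ F (allSubsets n)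

  A* : Subset n
  A* = Extrema.argmax ratio B inF

  A*∈F : T (F A*)
  A*∈F = Extrema.argmax-all ratio {P = T ∘ F} {B} {inF} B∈F (all-filter (T? ∘ F) (allSubsets n))

  A*-max : ∀ {A} → A ∈ inF → ratio A ℚ.≤ ratio A*
  A*-max = lookup (Extrema.f[xs]≤f[argmax] {f = ratio} B inF)

  inF-complete : ∀ A → F A ≡ true → A ∈ inF
  inF-complete A A∈F = ∈-filter⁺ {P = T ∘ F} (T? ∘ F) (allSubsets-complete n A) (Equivalence.from (T-≡ {F A}) A∈F)

  A*-best : ∀ A → F A ≡ true → G A * L A* ≤ G A* * L A
  A*-best A A∈F = ratio-≤⁻ (G A) (L A) (G A*) (L A*) {{L≢0 A}} {{L≢0 A*}} (A*-max (inF-complete A A∈F))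

  ℓ/p-bound : (H : Subset n → ℕ) (root : Subset n) →
    G root ≡ chainSum ∅ full (countOn F) → H root ≡ chainSum ∅ full (hits F) →
    G root * L A* ≤ G A* * H root →
    (ℓ F ÷' hitProb F) ℚ.≤ ι (G A*) ÷' ι (L A*)
  ℓ/p-bound H root G-root H-root ineq = ℚ.≤-trans (ℚ.≤-reflexive ℓ/p) bound
    where
    ℓ/p : ℓ F ÷' hitProb F ≡ (ι (G root) ÷' ι (n !)) ÷' (ι (H root) ÷' ι (n !))
    ℓ/p = cong₂ _÷'_ (trans (ℓ-by-chains F) (cong (λ g → ι g ÷' ι (n !)) (sym G-root)))
                      (trans (hitProb-by-chains F) (cong (λ h → ι h ÷' ι (n !)) (sym H-root)))
    bound : (ι (G root) ÷' ι (n !)) ÷' (ι (H root) ÷' ι (n !)) ℚ.≤ ι (G A*) ÷' ι (L A*)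
    bound = ratio-of-ratios-≤ (G root) (H root) (n !) (G A*) (L A*) {{n !≢0}} {{L≢0 A*}} ineq

module Upward (F : Family n) where

  G H L : Subset n → ℕ
  G X = chainSum X full (countOn F)
  H X = chainSum X full (hits F)
  L X = chainSum X full (λ _ → 1)

  next : Subset n → List (Subset n)
  next X = map (λ a → X ∪ ⁅ a ⁆) (elems (full ─ X))

  next-rank : ∀ {X Y} → Y ∈ next X → missing Y < missing X
  next-rank {X} Y∈ with ∈-map⁻ (λ a → X ∪ ⁅ a ⁆) Y∈
  ... | a , a∈ , refl = missing-∪ X a∈

  open BestRatio F next missing next-rank G H L
    (λ X X∈F → chainSum-starts X full {hits F} {λ _ → 1} (hits-head F X∈F))
    (λ X X∉F → trans (chainSum-skip-first X full (countOn F) (countOn-skip-head F X∉F) refl)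
                     (sym (∑-map (λ a → X ∪ ⁅ a ⁆) (elems (full ─ X)) G)))
    (λ X X∉F → trans (chainSum-skip-first X full (hits F) (hits-skip-head F X∉F) refl)
                     (sym (∑-map (λ a → X ∪ ⁅ a ⁆) (elems (full ─ X)) H)))
    public

module Downward (F : Family n) where

  G H L : Subset n → ℕ
  G Y = chainSum ∅ Y (countOn F)
  H Y = chainSum ∅ Y (hits F)
  L Y = chainSum ∅ Y (λ _ → 1)

  next : Subset n → List (Subset n)
  next Y = map (Y -_) (elems (Y ─ ∅))

  next-rank : ∀ {Y Z} → Z ∈ next Y → ∣ Z ─ ∅ ∣ < ∣ Y ─ ∅ ∣
  next-rank {Y} Z∈ with ∈-map⁻ (Y -_) Z∈
  ... | b , b∈ , refl = ≤-reflexive (∣-─∣ ∅ Y (elems-sound (Y ─ ∅) b∈))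

  open BestRatio F next (λ Y → ∣ Y ─ ∅ ∣) next-rank G H L
    (λ Y Y∈F → chainSum-ends ∅ Y {hits F} {λ _ → 1} (⊆-min Y) (hits-last F Y∈F))
    (λ Y Y∉F → trans (chainSum-skip-last ∅ Y (countOn F) (⊆-min Y) (countOn-skip-last F Y∉F) refl)
                     (sym (∑-map (Y -_) (elems (Y ─ ∅)) G)))
    (λ Y Y∉F → trans (chainSum-skip-last ∅ Y (hits F) (⊆-min Y) (hits-skip-last F Y∉F) refl)
                     (sym (∑-map (Y -_) (elems (Y ─ ∅)) H)))
    public

proposition2p1 : (n : ℕ) (F : Family n) → (∃ λ (B : Subset n) → T (F B)) →
    (Σ (Subset n) λ A → T (F A) × (ℓ F ÷' hitProb F) ℚ.≤ ℓ⁺ A F)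
    × (Σ (Subset n) λ A' → T (F A') × (ℓ F ÷' hitProb F) ℚ.≤ ℓ⁻ A' F)
proposition2p1 n F (B , B∈F) = (U.A* , U.A*∈F , upper) , (D.A* , D.A*∈F , lower)
  where
  module U = Choice F B B∈F (Upward.G F) (Upward.L F) (λ A → chainCount-nonZero A full)
  module D = Choice F B B∈F (Downward.G F) (Downward.L F) (λ A → chainCount-nonZero ∅ A)
  upper : ℓ F ÷' hitProb F ℚ.≤ ℓ⁺ U.A* F
  upper = ℚ.≤-trans (U.ℓ/p-bound (Upward.H F) ∅ refl refl (Upward.propagate F U.A* U.A*-best ∅))
                    (ℚ.≤-reflexive (sym (ℓI-by-chains F U.A* full)))
  lower : ℓ F ÷' hitProb F ℚ.≤ ℓ⁻ D.A* F
  lower = ℚ.≤-trans (D.ℓ/p-bound (Downward.H F) full refl refl (Downward.propagate F D.A* D.A*-best full))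
                    (ℚ.≤-reflexive (sym (ℓI-by-chains F ∅ D.A*)))
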